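{- Let $n$ be a positive integer, $m$ an integer with $0\leq m\leq 2n$, and $w$ an integer with $-n\leq w\leq n$. Then \[ \sum_{k=0}^{n-1}\binom{n-1-k}{k}\binom{n}{w+k}\binom{k+w}{m-k-w}(-1)^{k} =\sum_{k=-2w-n+m+1}^{m-w}\binom{n}{k+w}\binom{n}{n+k+w-m}\binom{k+n+2w-m-1}{k}(-1)^{k}. \]
   Context: Binomial coefficients $\binom{a}{b}$ are $0$ unless $0\le b\le a$ (for integers $a,b$). -}

module Defs where

open import Data.Nat as ℕ using (ℕ; zero; suc)
open import Data.Nat.Combinatorics using (_C_)
open import Data.Nat.DivMod using (_%_)
open import Data.Integer using (ℤ; +_; _+_; _-_; _*_; -_; ∣_∣; _≤?_; _⊔_; 0ℤ; 1ℤ)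
open import Relation.Nullary using (yes; no)

binom : ℤ → ℤ → ℤ
binom a b with 0ℤ ≤? b | b ≤? a
... | yes _ | yes _ = + (∣ a ∣ C ∣ b ∣)
... | _     | _     = 0ℤ

negOnePow : ℤ → ℤ
negOnePow k with ∣ k ∣ % 2
... | zero = 1ℤ
... | suc _ = - 1ℤ

sumN : ℕ → (ℕ → ℤ) → ℤ
sumN zero    f = 0ℤ
sumN (suc c) f = sumN c f + f c

-- Σ_{k=lo}^{hi} f k over integers k (empty sum, = 0, when hi < lo).
sumRange : ℤ → ℤ → (ℤ → ℤ) → ℤ
sumRange lo hi f = sumN ∣ (hi - lo + 1ℤ) ⊔ 0ℤ ∣ (λ i → f (lo + + i))

module Submission where

-- Write c N d = (-1)^d C(N-1-d, d).  After the substitution u = k + w both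
-- sides of corollary3 become binomial transforms  Σ_{i=0}^{t} C(t,i) g(i)
-- at t = n, of the two sequences
--     r k m w i = C(i, m-i) c(k, i-w),
--     q t k m w i = C(t, t+i-m) c(k+2i-m, i-w)      (with k = n).
-- Since Σ C(t+1,i) g(i) = Σ C(t,i) (g(i) + g(i+1)) (Pascal's rule), a family
-- whose neighbouring terms satisfy a "trinomial step" has transforms obeying
--     S(t+1, m, w) = S(t, m, w) + S(t, m-1, w-1) + S(t, m-2, w-1).
-- The family r satisfies it by Pascal's rule in its first factor; q satisfies it
-- (as long as t < k) by Pascal's rule together with the three-term recurrence
-- c(N-1, d) + c(N+1, d+1) = c(N, d+1).  As both transforms agree at t = 0, they
-- agree for all t ≤ k.  Finally the summation ranges of corollary3 are moved
-- to [0, n] using the vanishing of the summands outside their supports.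

open import Defs
open import Data.Nat as ℕ using (ℕ; zero; suc; z≤n)
import Data.Nat.Properties as ℕ
open import Data.Nat.Combinatorics using (_C_; k>n⇒nCk≡0; nCk+nC[k+1]≡[n+1]C[k+1])
open import Data.Integer
  using (ℤ; +_; -[1+_]; _+_; _-_; _*_; -_; ∣_∣; _≤_; _<_; _≤?_; _⊔_; +≤+; +<+; -<+; 0ℤ; 1ℤ; -1ℤ)
open import Data.Integer.Properties
  using (*-zeroʳ; ≤-refl; ≤-trans; <⇒≱; +-mono-≤; i≤j⇒0≤j-i; 0≤i-j⇒j≤i; i<j⇒suc[i]≤j; suc[i]≤j⇒i<j; 0≤i⇒+∣i∣≡i; i≥j⇒i⊔j≡i; _≟_)
open import Data.Integer.Tactic.RingSolver using (solve-∀)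
open import Data.Product using (∃-syntax; _,_)
open import Function using (_∘_)
open import Relation.Binary.PropositionalEquality
open import Relation.Nullary using (yes; no; contradiction)

cong₃ : ∀ {A B C D : Set} (f : A → B → C → D) {a a′ b b′ x x′} →
        a ≡ a′ → b ≡ b′ → x ≡ x′ → f a b x ≡ f a′ b′ x′
cong₃ f refl refl refl = refl

≤-by : ∀ {a b x} → 0ℤ ≤ x → x ≡ b - a → a ≤ b
≤-by 0≤x refl = 0≤i-j⇒j≤i 0≤x

<-by : ∀ {a b x} → 0ℤ ≤ x → x ≡ b - a - 1ℤ → a < b
<-by {a} {b} 0≤x eq = suc[i]≤j⇒i<j (≤-by 0≤x (trans eq (diff a b)))
  where diff : ∀ a b → b - a - 1ℤ ≡ b - (1ℤ + a)
        diff = solve-∀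

gap< : ∀ {a b} → a < b → 0ℤ ≤ b - a - 1ℤ
gap< {a} {b} a<b = subst (0ℤ ≤_) (diff a b) (i≤j⇒0≤j-i (i<j⇒suc[i]≤j a<b))
  where diff : ∀ a b → b - (1ℤ + a) ≡ b - a - 1ℤ
        diff = solve-∀

0≤+ : ∀ n → 0ℤ ≤ + n
0≤+ n = +≤+ z≤n

natGap : ∀ {a b} → a ≤ b → ∃[ p ] + p ≡ b - a
natGap {a} {b} a≤b = ∣ b - a ∣ , 0≤i⇒+∣i∣≡i (i≤j⇒0≤j-i a≤b)

binom-ℕ : ∀ a b → binom (+ a) (+ b) ≡ + (a C b)
binom-ℕ a b with 0ℤ ≤? + b | + b ≤? + a
... | yes _   | yes _   = refl
... | no 0≰b  | _       = contradiction (0≤+ b) 0≰b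
... | yes _   | no b≰a  = sym (cong +_ (k>n⇒nCk≡0 (ℕ.≰⇒> (b≰a ∘ +≤+))))

binom-neg : ∀ {a b} → b < 0ℤ → binom a b ≡ 0ℤ
binom-neg {a} {b} b<0 with 0ℤ ≤? b | b ≤? a
... | yes 0≤b | _ = contradiction 0≤b (<⇒≱ b<0)
... | no _    | _ = refl

binom-above : ∀ {a b} → a < b → binom a b ≡ 0ℤ
binom-above {a} {b} a<b with 0ℤ ≤? b | b ≤? a
... | _     | yes b≤a = contradiction b≤a (<⇒≱ a<b)
... | yes _ | no _    = refl
... | no _  | no _    = refl

binom-negTop : ∀ {a b} → a < 0ℤ → binom a b ≡ 0ℤ
binom-negTop {a} {b} a<0 with 0ℤ ≤? b | b ≤? a
... | yes 0≤b | yes b≤a = contradiction (≤-trans 0≤b b≤a) (<⇒≱ a<0)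
... | yes _   | no _    = refl
... | no _    | _       = refl

pascal : ∀ a b → binom (+ suc a) b ≡ binom (+ a) (b - 1ℤ) + binom (+ a) b
pascal a (+ zero) rewrite binom-ℕ (suc a) 0 | binom-ℕ a 0 = refl
pascal a (+ suc b) rewrite binom-ℕ (suc a) (suc b) | binom-ℕ a b | binom-ℕ a (suc b) =
  sym (cong +_ (nCk+nC[k+1]≡[n+1]C[k+1] a b))
pascal a -[1+ b ] = refl

-- Pascal's rule for integer entries; its single exception is a = b = -1,
-- where C(0,0) = 1 but both terms on the right vanish.
pascal-ℤ : ∀ a b → (a ≡ -1ℤ → b ≢ -1ℤ) →
           binom (1ℤ + a) (1ℤ + b) ≡ binom a b + binom a (1ℤ + b)
pascal-ℤ (+ a) b _ = trans (pascal a (1ℤ + b)) (cong (λ z → binom (+ a) z + binom (+ a) (1ℤ + b)) (cancel b))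
  where cancel : ∀ b → 1ℤ + b - 1ℤ ≡ b
        cancel = solve-∀
pascal-ℤ -[1+ suc a ] b _
  rewrite binom-negTop { -[1+ a ]} {1ℤ + b} -<+
        | binom-negTop { -[1+ suc a ]} {b} -<+
        | binom-negTop { -[1+ suc a ]} {1ℤ + b} -<+ = refl
pascal-ℤ -[1+ 0 ] (+ b)            _     = refl
pascal-ℤ -[1+ 0 ] -[1+ 0 ]         b≢-1 = contradiction refl (b≢-1 refl)
pascal-ℤ -[1+ 0 ] -[1+ suc b ]     _     = refl

negOnePow-sucℕ : ∀ n → negOnePow (+ suc n) ≡ - negOnePow (+ n)
negOnePow-sucℕ 0             = refl
negOnePow-sucℕ 1             = refl
negOnePow-sucℕ (suc (suc n)) = negOnePow-sucℕ n

negOnePow-suc : ∀ d → negOnePow (1ℤ + d) ≡ - negOnePow d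
negOnePow-suc (+ n)          = negOnePow-sucℕ n
negOnePow-suc -[1+ 0 ]       = refl
negOnePow-suc -[1+ suc n ]   = negOnePow-sucℕ n

-- Functions ℤ → ℤ vanishing outside an interval.  This is what allows the
-- summation ranges of the corollary to be changed.

record Supported (a b : ℤ) (F : ℤ → ℤ) : Set where
  field
    below : ∀ u → u < a → F u ≡ 0ℤ
    above : ∀ u → b < u → F u ≡ 0ℤ
open Supported

supported-*ˡ : ∀ {a b F} (G : ℤ → ℤ) → Supported a b F → Supported a b (λ u → G u * F u)
supported-*ˡ G S = record
  { below = λ u u<a → trans (cong (G u *_) (below S u u<a)) (*-zeroʳ (G u))
  ; above = λ u b<u → trans (cong (G u *_) (above S u b<u)) (*-zeroʳ (G u)) }

supported-shift : ∀ {a b F} s → Supported a b F → Supported (a + s) (b + s) (λ u → F (u - s))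
supported-shift {a} {b} s S = record
  { below = λ u u<a+s → below S (u - s) (<-by (gap< u<a+s) (shift a u s))
  ; above = λ u b+s<u → above S (u - s) (<-by (gap< b+s<u) (shift′ u b s)) }
  where shift : ∀ a u s → a + s - u - 1ℤ ≡ a - (u - s) - 1ℤ
        shift = solve-∀
        shift′ : ∀ u b s → u - (b + s) - 1ℤ ≡ (u - s) - b - 1ℤ
        shift′ = solve-∀

supported-*ʳ : ∀ {a b F} (G : ℤ → ℤ) → Supported a b F → Supported a b (λ u → F u * G u)
supported-*ʳ G S = record
  { below = λ u u<a → cong (_* G u) (below S u u<a)
  ; above = λ u b<u → cong (_* G u) (above S u b<u) }

binom-supported : ∀ n → Supported 0ℤ (+ n) (binom (+ n))
binom-supported n = record { below = λ _ → binom-neg ; above = λ _ → binom-above }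

-- The sequence c N d = (-1)^d C(N-1-d, d); for fixed N these are the
-- coefficients of the Chebyshev polynomial U_{N-1}(x/2).

c : ℤ → ℤ → ℤ
c N d = binom (N - 1ℤ - d) d * negOnePow d

c-supported : ∀ N → Supported 0ℤ (+ N - 1ℤ) (c (+ N))
c-supported N = record
  { below = λ d d<0 → cong (_* negOnePow d) (binom-neg d<0)
  ; above = λ d N-1<d → cong (_* negOnePow d) (binom-above (top<d d (gap< N-1<d)))  }
  where
    diff : ∀ N d → (d - (N - 1ℤ) - 1ℤ) + (d - (N - 1ℤ) - 1ℤ) + N ≡ d - (N - 1ℤ - d) - 1ℤ
    diff = solve-∀
    top<d : ∀ d → 0ℤ ≤ d - (+ N - 1ℤ) - 1ℤ → + N - 1ℤ - d < d
    top<d d 0≤x = <-by (+-mono-≤ (+-mono-≤ 0≤x 0≤x) (0≤+ N)) (diff (+ N) d)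

c-rec : ∀ N d → (N ≡ 0ℤ → d ≢ -1ℤ) → c (N - 1ℤ) d + c (1ℤ + N) (1ℤ + d) ≡ c N (1ℤ + d)
c-rec N d exception =
  begin
    binom a d * s + binom (1ℤ + N - 1ℤ - (1ℤ + d)) (1ℤ + d) * negOnePow (1ℤ + d)
  ≡⟨ cong₂ (λ x y → binom a d * s + binom x (1ℤ + d) * y) (top-next N d) (negOnePow-suc d) ⟩
    binom a d * s + binom (1ℤ + a) (1ℤ + d) * (- s)
  ≡⟨ cong (λ x → binom a d * s + x * (- s)) (pascal-ℤ a d a≢-1) ⟩
    binom a d * s + (binom a d + binom a (1ℤ + d)) * (- s)
  ≡⟨ telescope (binom a d) (binom a (1ℤ + d)) s ⟩
    binom a (1ℤ + d) * (- s)
  ≡⟨ sym (cong₂ (λ x y → binom x (1ℤ + d) * y) (top-here N d) (negOnePow-suc d)) ⟩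
    c N (1ℤ + d)
  ∎
  where
    open ≡-Reasoning
    a = N - 1ℤ - 1ℤ - d
    s = negOnePow d
    top-next : ∀ N d → 1ℤ + N - 1ℤ - (1ℤ + d) ≡ 1ℤ + (N - 1ℤ - 1ℤ - d)
    top-next = solve-∀
    top-here : ∀ N d → N - 1ℤ - (1ℤ + d) ≡ N - 1ℤ - 1ℤ - d
    top-here = solve-∀
    telescope : ∀ x y z → x * z + (x + y) * (- z) ≡ y * (- z)
    telescope = solve-∀
    recover : ∀ N d → N ≡ (N - 1ℤ - 1ℤ - d) + 1ℤ + 1ℤ + d
    recover = solve-∀
    a≢-1 : a ≡ -1ℤ → d ≢ -1ℤ
    a≢-1 a≡-1 d≡-1 = exception (trans (recover N d) (cong₂ (λ x y → x + 1ℤ + 1ℤ + y) a≡-1 d≡-1)) d≡-1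

sumN-cong : ∀ c {f g : ℕ → ℤ} → (∀ i → f i ≡ g i) → sumN c f ≡ sumN c g
sumN-cong zero    f≡g = refl
sumN-cong (suc c) f≡g = cong₂ _+_ (sumN-cong c f≡g) (f≡g c)

sumN-+ : ∀ c (f g : ℕ → ℤ) → sumN c (λ i → f i + g i) ≡ sumN c f + sumN c g
sumN-+ zero    f g = refl
sumN-+ (suc c) f g = trans (cong (_+ (f c + g c)) (sumN-+ c f g)) (swap (sumN c f) (sumN c g) (f c) (g c))
  where swap : ∀ a b x y → a + b + (x + y) ≡ a + x + (b + y)
        swap = solve-∀

sumN-split : ∀ p q (f : ℕ → ℤ) → sumN (p ℕ.+ q) f ≡ sumN p f + sumN q (λ i → f (p ℕ.+ i))
sumN-split p zero f rewrite ℕ.+-identityʳ p = sym (plus-zero (sumN p f))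
  where plus-zero : ∀ x → x + 0ℤ ≡ x
        plus-zero = solve-∀
sumN-split p (suc q) f rewrite ℕ.+-suc p q =
  trans (cong (_+ f (p ℕ.+ q)) (sumN-split p q f)) (assoc (sumN p f) (sumN q (λ i → f (p ℕ.+ i))) (f (p ℕ.+ q)))
  where assoc : ∀ a b x → a + b + x ≡ a + (b + x)
        assoc = solve-∀

sumN-zero : ∀ c (f : ℕ → ℤ) → (∀ i → i ℕ.< c → f i ≡ 0ℤ) → sumN c f ≡ 0ℤ
sumN-zero zero    f _ = refl
sumN-zero (suc c) f vanish
  rewrite sumN-zero c f (λ i i<c → vanish i (ℕ.m<n⇒m<1+n i<c)) | vanish c (ℕ.n<1+n c) = refl

binomialSum : ℕ → (ℕ → ℤ) → ℤ
binomialSum t g = sumN (suc t) (λ i → binom (+ t) (+ i) * g i)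

binomialSum-cong : ∀ t {g h : ℕ → ℤ} → (∀ i → g i ≡ h i) → binomialSum t g ≡ binomialSum t h
binomialSum-cong t g≡h = sumN-cong (suc t) (λ i → cong (binom (+ t) (+ i) *_) (g≡h i))

binomialSum-+ : ∀ t (g h : ℕ → ℤ) → binomialSum t (λ i → g i + h i) ≡ binomialSum t g + binomialSum t h
binomialSum-+ t g h =
  trans (sumN-cong (suc t) (λ i → distrib (binom (+ t) (+ i)) (g i) (h i))) (sumN-+ (suc t) _ _)
  where distrib : ∀ x y z → x * (y + z) ≡ x * y + x * z
        distrib = solve-∀

binomialSum-pascal : ∀ t (g : ℕ → ℤ) → binomialSum (suc t) g ≡ binomialSum t (λ i → g i + g (suc i))
binomialSum-pascal t g =
  begin
    binomialSum (suc t) g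
  ≡⟨ sumN-cong (suc (suc t)) (λ i → trans (cong (_* g i) (pascal t (+ i))) (distrib (binom (+ t) (+ i - 1ℤ)) (binom (+ t) (+ i)) (g i))) ⟩
    sumN (suc (suc t)) (λ i → binom (+ t) (+ i - 1ℤ) * g i + binom (+ t) (+ i) * g i)
  ≡⟨ sumN-+ (suc (suc t)) _ _ ⟩
    sumN (suc (suc t)) (λ i → binom (+ t) (+ i - 1ℤ) * g i) + sumN (suc (suc t)) (λ i → binom (+ t) (+ i) * g i)
  ≡⟨ cong₂ _+_ (sumN-split 1 (suc t) _) (cong (λ z → binomialSum t g + z) (cong (_* g (suc t)) C[t,t+1]≡0)) ⟩
    (0ℤ + 0ℤ * g 0 + binomialSum t (g ∘ suc)) + (binomialSum t g + 0ℤ * g (suc t))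
  ≡⟨ tidy (binomialSum t (g ∘ suc)) (binomialSum t g) (g 0) (g (suc t)) ⟩
    binomialSum t g + binomialSum t (g ∘ suc)
  ≡⟨ sym (binomialSum-+ t g (g ∘ suc)) ⟩
    binomialSum t (λ i → g i + g (suc i))
  ∎
  where
    open ≡-Reasoning
    distrib : ∀ x y z → (x + y) * z ≡ x * z + y * z
    distrib = solve-∀
    tidy : ∀ a b x y → (0ℤ + 0ℤ * x + a) + (b + 0ℤ * y) ≡ b + a
    tidy = solve-∀
    C[t,t+1]≡0 : binom (+ t) (+ suc t) ≡ 0ℤ
    C[t,t+1]≡0 = binom-above (+<+ (ℕ.n<1+n t))

TrinomialStep : (ℕ → ℤ → ℤ → ℕ → ℤ) → ℕ → Set
TrinomialStep s t = ∀ m w i →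
  s (suc t) m w i + s (suc t) m w (suc i) ≡ s t m w i + s t (m - 1ℤ) (w - 1ℤ) i + s t (m - + 2) (w - 1ℤ) i

binomialSum-step : ∀ s t → TrinomialStep s t → ∀ m w →
  binomialSum (suc t) (s (suc t) m w)
    ≡ binomialSum t (s t m w) + binomialSum t (s t (m - 1ℤ) (w - 1ℤ)) + binomialSum t (s t (m - + 2) (w - 1ℤ))
binomialSum-step s t step m w =
  begin
    binomialSum (suc t) (s (suc t) m w)
  ≡⟨ binomialSum-pascal t _ ⟩
    binomialSum t (λ i → s (suc t) m w i + s (suc t) m w (suc i))
  ≡⟨ binomialSum-cong t (step m w) ⟩
    binomialSum t (λ i → s t m w i + s t (m - 1ℤ) (w - 1ℤ) i + s t (m - + 2) (w - 1ℤ) i)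
  ≡⟨ binomialSum-+ t _ _ ⟩
    binomialSum t (λ i → s t m w i + s t (m - 1ℤ) (w - 1ℤ) i) + binomialSum t (s t (m - + 2) (w - 1ℤ))
  ≡⟨ cong (_+ binomialSum t (s t (m - + 2) (w - 1ℤ))) (binomialSum-+ t _ _) ⟩
    binomialSum t (s t m w) + binomialSum t (s t (m - 1ℤ) (w - 1ℤ)) + binomialSum t (s t (m - + 2) (w - 1ℤ))
  ∎
  where open ≡-Reasoning

trinomial-uniqueness : ∀ s s′ k →
  (∀ t → suc t ℕ.≤ k → TrinomialStep s t) → (∀ t → suc t ℕ.≤ k → TrinomialStep s′ t) →
  (∀ m w → s 0 m w 0 ≡ s′ 0 m w 0) →
  ∀ t → t ℕ.≤ k → ∀ m w → binomialSum t (s t m w) ≡ binomialSum t (s′ t m w)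
trinomial-uniqueness s s′ k step step′ origin zero _ m w = cong (λ z → 0ℤ + z) (cong (1ℤ *_) (origin m w))
trinomial-uniqueness s s′ k step step′ origin (suc t) t<k m w =
  trans (binomialSum-step s t (step t t<k) m w)
    (trans (cong₃ (λ x y z → x + y + z) (ih m w) (ih (m - 1ℤ) (w - 1ℤ)) (ih (m - + 2) (w - 1ℤ)))
           (sym (binomialSum-step s′ t (step′ t t<k) m w)))
  where ih = trinomial-uniqueness s s′ k step step′ origin t (ℕ.<⇒≤ t<k)

r : ℕ → ℤ → ℤ → ℕ → ℤ
r k m w i = binom (+ i) (m - + i) * c (+ k) (+ i - w)

q : ℕ → ℕ → ℤ → ℤ → ℕ → ℤ
q t k m w i = binom (+ t) (+ t + + i - m) * c (+ k + + i + + i - m) (+ i - w)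

-- Pascal's rule in the first factor of r.
r-next : ∀ k m w i → r k m w (suc i) ≡ r k (m - 1ℤ) (w - 1ℤ) i + r k (m - + 2) (w - 1ℤ) i
r-next k m w i =
  begin
    binom (+ suc i) (m - + suc i) * c (+ k) (+ suc i - w)
  ≡⟨ cong (_* c (+ k) (+ suc i - w)) (pascal i (m - + suc i)) ⟩
    (binom (+ i) (m - + suc i - 1ℤ) + binom (+ i) (m - + suc i)) * c (+ k) (+ suc i - w)
  ≡⟨ cong₃ (λ x y z → (binom (+ i) x + binom (+ i) y) * c (+ k) z) (index₂ m (+ i)) (index₁ m (+ i)) (shift w (+ i)) ⟩
    (binom (+ i) ((m - + 2) - + i) + binom (+ i) ((m - 1ℤ) - + i)) * c (+ k) (+ i - (w - 1ℤ))
  ≡⟨ distrib (binom (+ i) ((m - + 2) - + i)) (binom (+ i) ((m - 1ℤ) - + i)) (c (+ k) (+ i - (w - 1ℤ))) ⟩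
    r k (m - 1ℤ) (w - 1ℤ) i + r k (m - + 2) (w - 1ℤ) i
  ∎
  where
    open ≡-Reasoning
    index₂ : ∀ m j → m - (1ℤ + j) - 1ℤ ≡ (m - + 2) - j
    index₂ = solve-∀
    index₁ : ∀ m j → m - (1ℤ + j) ≡ (m - 1ℤ) - j
    index₁ = solve-∀
    shift : ∀ w j → (1ℤ + j) - w ≡ j - (w - 1ℤ)
    shift = solve-∀
    distrib : ∀ x y z → (x + y) * z ≡ y * z + x * z
    distrib = solve-∀

r-step : ∀ k t → TrinomialStep (λ _ → r k) t
r-step k t m w i = trans (cong (λ z → r k m w i + z) (r-next k m w i)) (assoc (r k m w i) _ _)
  where assoc : ∀ x y z → x + (y + z) ≡ x + y + z
        assoc = solve-∀

-- Pascal's rule in the first factor of q, applied to the terms i (q-here) and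
-- i+1 (q-next) at level t+1.  The middle binomial W = C(t, t+i-(m-1)) appears
-- in both, next to c(N-1, d) and c(N+1, d+1) respectively.
module QTerms (t k : ℕ) (m w : ℤ) (i : ℕ) where
  W : ℤ
  W = binom (+ t) (+ t + + i - (m - 1ℤ))

  N d : ℤ
  N = + k + + i + + i - (m - 1ℤ)
  d = + i - w

  q-here : q (suc t) k m w i ≡ q t k m w i + W * c (N - 1ℤ) d
  q-here =
    begin
      binom (+ suc t) (+ suc t + + i - m) * c (+ k + + i + + i - m) d
    ≡⟨ cong (_* c (+ k + + i + + i - m) d) (pascal t (+ suc t + + i - m)) ⟩
      (binom (+ t) (+ suc t + + i - m - 1ℤ) + binom (+ t) (+ suc t + + i - m)) * c (+ k + + i + + i - m) d
    ≡⟨ cong₂ (λ x y → (binom (+ t) x + binom (+ t) y) * c (+ k + + i + + i - m) d) (index₀ (+ t) (+ i) m) (index₁ (+ t) (+ i) m) ⟩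
      (binom (+ t) (+ t + + i - m) + W) * c (+ k + + i + + i - m) d
    ≡⟨ distrib (binom (+ t) (+ t + + i - m)) W (c (+ k + + i + + i - m) d) ⟩
      q t k m w i + W * c (+ k + + i + + i - m) d
    ≡⟨ cong (λ z → q t k m w i + W * c z d) (top (+ k) (+ i) m) ⟩
      q t k m w i + W * c (N - 1ℤ) d
    ∎
    where
      open ≡-Reasoning
      index₀ : ∀ t j m → 1ℤ + t + j - m - 1ℤ ≡ t + j - m
      index₀ = solve-∀
      index₁ : ∀ t j m → 1ℤ + t + j - m ≡ t + j - (m - 1ℤ)
      index₁ = solve-∀
      top : ∀ k j m → k + j + j - m ≡ k + j + j - (m - 1ℤ) - 1ℤ
      top = solve-∀
      distrib : ∀ x y z → (x + y) * z ≡ x * z + y * z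
      distrib = solve-∀

  q-next : q (suc t) k m w (suc i) ≡ W * c (1ℤ + N) (1ℤ + d) + q t k (m - + 2) (w - 1ℤ) i
  q-next =
    begin
      binom (+ suc t) (+ suc t + + suc i - m) * c (+ k + + suc i + + suc i - m) (+ suc i - w)
    ≡⟨ cong (_* c (+ k + + suc i + + suc i - m) (+ suc i - w)) (pascal t (+ suc t + + suc i - m)) ⟩
      (binom (+ t) (+ suc t + + suc i - m - 1ℤ) + binom (+ t) (+ suc t + + suc i - m))
        * c (+ k + + suc i + + suc i - m) (+ suc i - w)
    ≡⟨ cong₂ (λ x y → (binom (+ t) x + binom (+ t) y) * c (+ k + + suc i + + suc i - m) (+ suc i - w))
             (index₁ (+ t) (+ i) m) (index₂ (+ t) (+ i) m) ⟩
      (W + binom (+ t) (+ t + + i - (m - + 2))) * c (+ k + + suc i + + suc i - m) (+ suc i - w)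
    ≡⟨ distrib W (binom (+ t) (+ t + + i - (m - + 2))) (c (+ k + + suc i + + suc i - m) (+ suc i - w)) ⟩
      W * c (+ k + + suc i + + suc i - m) (+ suc i - w)
        + binom (+ t) (+ t + + i - (m - + 2)) * c (+ k + + suc i + + suc i - m) (+ suc i - w)
    ≡⟨ cong₂ _+_ (cong₂ (λ x y → W * c x y) (top₊ (+ k) (+ i) m) (shift w (+ i)))
                 (cong₂ (λ x y → binom (+ t) (+ t + + i - (m - + 2)) * c x y) (top₂ (+ k) (+ i) m) (shift′ w (+ i))) ⟩
      W * c (1ℤ + N) (1ℤ + d) + q t k (m - + 2) (w - 1ℤ) i
    ∎
    where
      open ≡-Reasoning
      index₁ : ∀ t j m → 1ℤ + t + (1ℤ + j) - m - 1ℤ ≡ t + j - (m - 1ℤ)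
      index₁ = solve-∀
      index₂ : ∀ t j m → 1ℤ + t + (1ℤ + j) - m ≡ t + j - (m - + 2)
      index₂ = solve-∀
      distrib : ∀ x y z → (x + y) * z ≡ x * z + y * z
      distrib = solve-∀
      top₊ : ∀ k j m → k + (1ℤ + j) + (1ℤ + j) - m ≡ 1ℤ + (k + j + j - (m - 1ℤ))
      top₊ = solve-∀
      shift : ∀ w j → (1ℤ + j) - w ≡ 1ℤ + (j - w)
      shift = solve-∀
      top₂ : ∀ k j m → k + (1ℤ + j) + (1ℤ + j) - m ≡ k + j + j - (m - + 2)
      top₂ = solve-∀
      shift′ : ∀ w j → (1ℤ + j) - w ≡ j - (w - 1ℤ)
      shift′ = solve-∀

  -- The two copies of W combine by the recurrence of c.  At its exception
  -- N = 0 the index of W is negative, because t < k.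
  q-middle : suc t ℕ.≤ k → W * c (N - 1ℤ) d + W * c (1ℤ + N) (1ℤ + d) ≡ q t k (m - 1ℤ) (w - 1ℤ) i
  q-middle t<k with N ≟ 0ℤ
  ... | no N≢0 =
    trans (sym (distrib W (c (N - 1ℤ) d) (c (1ℤ + N) (1ℤ + d))))
          (cong (W *_) (trans (c-rec N d (λ N≡0 _ → N≢0 N≡0)) (cong (c N) (shift w (+ i)))))
    where
      distrib : ∀ x y z → x * (y + z) ≡ x * y + x * z
      distrib = solve-∀
      shift : ∀ w j → 1ℤ + (j - w) ≡ j - (w - 1ℤ)
      shift = solve-∀
  ... | yes N≡0 =
    trans (cong₂ _+_ (cong (_* c (N - 1ℤ) d) W≡0) (cong (_* c (1ℤ + N) (1ℤ + d)) W≡0))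
          (sym (cong (_* c N (+ i - (w - 1ℤ))) W≡0))
    where
      excess : ∀ k t j m → (k - (1ℤ + t)) + j - (k + j + j - (m - 1ℤ)) ≡ 0ℤ - (t + j - (m - 1ℤ)) - 1ℤ
      excess = solve-∀
      plus-zero : ∀ x → x - 0ℤ ≡ x
      plus-zero = solve-∀
      index<0 : + t + + i - (m - 1ℤ) < 0ℤ
      index<0 = <-by (+-mono-≤ (i≤j⇒0≤j-i (+≤+ t<k)) (0≤+ i))
        (trans (sym (plus-zero _)) (trans (cong (λ z → (+ k - (1ℤ + + t)) + + i - z) (sym N≡0)) (excess (+ k) (+ t) (+ i) m)))
      W≡0 : W ≡ 0ℤ
      W≡0 = binom-neg index<0

q-step : ∀ k t → suc t ℕ.≤ k → TrinomialStep (λ t → q t k) t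
q-step k t t<k m w i =
  begin
    q (suc t) k m w i + q (suc t) k m w (suc i)
  ≡⟨ cong₂ _+_ q-here q-next ⟩
    (q t k m w i + W * c (N - 1ℤ) d) + (W * c (1ℤ + N) (1ℤ + d) + q t k (m - + 2) (w - 1ℤ) i)
  ≡⟨ regroup (q t k m w i) (W * c (N - 1ℤ) d) (W * c (1ℤ + N) (1ℤ + d)) (q t k (m - + 2) (w - 1ℤ) i) ⟩
    q t k m w i + (W * c (N - 1ℤ) d + W * c (1ℤ + N) (1ℤ + d)) + q t k (m - + 2) (w - 1ℤ) i
  ≡⟨ cong (λ z → q t k m w i + z + q t k (m - + 2) (w - 1ℤ) i) (q-middle t<k) ⟩
    q t k m w i + q t k (m - 1ℤ) (w - 1ℤ) i + q t k (m - + 2) (w - 1ℤ) i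
  ∎
  where
    open ≡-Reasoning
    open QTerms t k m w i
    regroup : ∀ a x y b → (a + x) + (y + b) ≡ a + (x + y) + b
    regroup = solve-∀

q-r-origin : ∀ k m w → q 0 k m w 0 ≡ r k m w 0
q-r-origin k (+ zero)    w = cong (λ N → 1ℤ * c N (+ 0 - w)) (plus-zeros (+ k))
  where plus-zeros : ∀ k → k + 0ℤ + 0ℤ - 0ℤ ≡ k
        plus-zeros = solve-∀
q-r-origin k (+ suc m)   w = refl
q-r-origin k -[1+ m ]    w = refl

transform-identity : ∀ k t → t ℕ.≤ k → ∀ m w → binomialSum t (q t k m w) ≡ binomialSum t (r k m w)
transform-identity k = trinomial-uniqueness (λ t → q t k) (λ _ → r k) k (q-step k) (λ t _ → r-step k t) (q-r-origin k)

sumRange-length : ∀ lo hi L F → hi - lo + 1ℤ ≡ + L → sumRange lo hi F ≡ sumN L (λ i → F (lo + + i))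
sumRange-length lo hi L F len =
  cong (λ z → sumN ∣ z ∣ (λ i → F (lo + + i))) (trans (cong (_⊔ 0ℤ) len) (i≥j⇒i⊔j≡i (0≤+ L)))

sumRange-cong : ∀ lo hi {F G : ℤ → ℤ} → (∀ u → F u ≡ G u) → sumRange lo hi F ≡ sumRange lo hi G
sumRange-cong lo hi F≡G = sumN-cong ∣ (hi - lo + 1ℤ) ⊔ 0ℤ ∣ (λ i → F≡G (lo + + i))

sumRange-shift : ∀ lo hi s F → sumRange lo hi (λ k → F (k + s)) ≡ sumRange (lo + s) (hi + s) F
sumRange-shift lo hi s F =
  trans (cong (λ z → sumN ∣ z ⊔ 0ℤ ∣ (λ i → F (lo + + i + s))) (length hi lo s))
        (sumN-cong ∣ (hi + s) - (lo + s) + 1ℤ ⊔ 0ℤ ∣ (λ i → cong F (index lo (+ i) s)))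
  where length : ∀ hi lo s → hi - lo + 1ℤ ≡ (hi + s) - (lo + s) + 1ℤ
        length = solve-∀
        index : ∀ lo j s → lo + j + s ≡ lo + s + j
        index = solve-∀

sumRange-from-zero : ∀ t F → sumRange 0ℤ (+ t) F ≡ sumN (suc t) (λ i → F (+ i))
sumRange-from-zero t F = sumRange-length 0ℤ (+ t) (suc t) F (length (+ t))
  where length : ∀ x → x - 0ℤ + 1ℤ ≡ 1ℤ + x
        length = solve-∀

sumRange-dropPrefix : ∀ {lo a hi} F → lo ≤ a → a ≤ hi + 1ℤ → (∀ u → u < a → F u ≡ 0ℤ) →
                      sumRange lo hi F ≡ sumRange a hi F
sumRange-dropPrefix {lo} {a} {hi} F lo≤a a≤hi+1 vanish with natGap lo≤a | natGap a≤hi+1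
... | p , p≡a-lo | L , L≡len =
  begin
    sumRange lo hi F
  ≡⟨ sumRange-length lo hi (p ℕ.+ L) F (trans (split lo a hi) (sym (cong₂ _+_ p≡a-lo L≡len))) ⟩
    sumN (p ℕ.+ L) (λ i → F (lo + + i))
  ≡⟨ sumN-split p L _ ⟩
    sumN p (λ i → F (lo + + i)) + sumN L (λ i → F (lo + + (p ℕ.+ i)))
  ≡⟨ cong₂ _+_ (sumN-zero p _ prefix-zero) (sumN-cong L (λ i → cong F (trans (cong (λ x → lo + (x + + i)) p≡a-lo) (index lo a (+ i))))) ⟩
    0ℤ + sumN L (λ i → F (a + + i))
  ≡⟨ zero-plus _ ⟩
    sumN L (λ i → F (a + + i))
  ≡⟨ sym (sumRange-length a hi L F (trans (length a hi) (sym L≡len))) ⟩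
    sumRange a hi F
  ∎
  where
    open ≡-Reasoning
    split : ∀ lo a hi → hi - lo + 1ℤ ≡ (a - lo) + (hi + 1ℤ - a)
    split = solve-∀
    zero-plus : ∀ x → 0ℤ + x ≡ x
    zero-plus = solve-∀
    index : ∀ lo a j → lo + ((a - lo) + j) ≡ a + j
    index = solve-∀
    length : ∀ a hi → hi - a + 1ℤ ≡ hi + 1ℤ - a
    length = solve-∀
    distance : ∀ a lo j → a - lo - j - 1ℤ ≡ a - (lo + j) - 1ℤ
    distance = solve-∀
    prefix-zero : ∀ i → i ℕ.< p → F (lo + + i) ≡ 0ℤ
    prefix-zero i i<p = vanish (lo + + i)
      (<-by (gap< (+<+ i<p)) (trans (cong (λ x → x - + i - 1ℤ) p≡a-lo) (distance a lo (+ i))))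

sumRange-dropSuffix : ∀ {a b hi} F → a ≤ b + 1ℤ → b ≤ hi → (∀ u → b < u → F u ≡ 0ℤ) →
                      sumRange a hi F ≡ sumRange a b F
sumRange-dropSuffix {a} {b} {hi} F a≤b+1 b≤hi vanish with natGap a≤b+1 | natGap b≤hi
... | L , L≡len | p , p≡hi-b =
  begin
    sumRange a hi F
  ≡⟨ sumRange-length a hi (L ℕ.+ p) F (trans (split a b hi) (sym (cong₂ _+_ L≡len p≡hi-b))) ⟩
    sumN (L ℕ.+ p) (λ i → F (a + + i))
  ≡⟨ sumN-split L p _ ⟩
    sumN L (λ i → F (a + + i)) + sumN p (λ i → F (a + + (L ℕ.+ i)))
  ≡⟨ cong (λ z → sumN L (λ i → F (a + + i)) + z) (sumN-zero p _ suffix-zero) ⟩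
    sumN L (λ i → F (a + + i)) + 0ℤ
  ≡⟨ plus-zero _ ⟩
    sumN L (λ i → F (a + + i))
  ≡⟨ sym (sumRange-length a b L F (trans (length a b) (sym L≡len))) ⟩
    sumRange a b F
  ∎
  where
    open ≡-Reasoning
    split : ∀ a b hi → hi - a + 1ℤ ≡ (b + 1ℤ - a) + (hi - b)
    split = solve-∀
    length : ∀ a b → b - a + 1ℤ ≡ b + 1ℤ - a
    length = solve-∀
    plus-zero : ∀ x → x + 0ℤ ≡ x
    plus-zero = solve-∀
    distance : ∀ a b j → j ≡ a + ((b + 1ℤ - a) + j) - b - 1ℤ
    distance = solve-∀
    suffix-zero : ∀ i → i ℕ.< p → F (a + + (L ℕ.+ i)) ≡ 0ℤ
    suffix-zero i _ = vanish (a + + (L ℕ.+ i))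
      (<-by (0≤+ i) (trans (distance a b (+ i)) (cong (λ x → a + (x + + i) - b - 1ℤ) (sym L≡len))))

record Inside (lo hi a b : ℤ) : Set where
  constructor inside
  field
    lo≤a   : lo ≤ a
    a≤b+1  : a ≤ b + 1ℤ
    b≤hi   : b ≤ hi

sumRange-enlarge : ∀ {lo hi a b} F → Inside lo hi a b → Supported a b F → sumRange lo hi F ≡ sumRange a b F
sumRange-enlarge {hi = hi} F (inside lo≤a a≤b+1 b≤hi) S =
  trans (sumRange-dropPrefix {hi = hi} F lo≤a (≤-trans a≤b+1 (+-mono-≤ b≤hi (≤-refl {1ℤ}))) (below S))
        (sumRange-dropSuffix F a≤b+1 b≤hi (above S))

sumRange-resupport : ∀ {lo hi a b a′ b′} F → Inside lo hi a b → Inside lo hi a′ b′ →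
                     Supported a b F → Supported a′ b′ F → sumRange a b F ≡ sumRange a′ b′ F
sumRange-resupport F I I′ S S′ = trans (sym (sumRange-enlarge F I S)) (sumRange-enlarge F I′ S′)

-- The summands of the two sides of the corollary, as functions of u = k + w.
-- At u = i ∈ ℕ they are the terms C(n,i) r n m w i and C(n,i) q n n m w i.
lhsTerm rhsTerm : ℕ → ℤ → ℤ → ℤ → ℤ
lhsTerm n m w u = binom (+ n) u * (binom u (m - u) * c (+ n) (u - w))
rhsTerm n m w u = binom (+ n) u * (binom (+ n) (+ n + u - m) * c (+ n + u + u - m) (u - w))

-- Under the hypotheses of the corollary both summands are supported on the
-- row [0, n] and on their recentred summation range; all these intervals lie
-- in the window [-2n, 2n].
module Corollary (n : ℕ) (m w : ℤ) (0≤m : + 0 ≤ m) (m≤2n : m ≤ + 2 * + n) (-n≤w : - (+ n) ≤ w) (w≤n : w ≤ + n) where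

  hull-lo hull-hi : ℤ
  hull-lo = - (+ n + + n)
  hull-hi = + n + + n

  gap-w : 0ℤ ≤ w - - (+ n)
  gap-w = i≤j⇒0≤j-i -n≤w

  gap-n-w : 0ℤ ≤ + n - w
  gap-n-w = i≤j⇒0≤j-i w≤n

  row-inside : Inside hull-lo hull-hi 0ℤ (+ n)
  row-inside = inside (≤-by (+-mono-≤ (0≤+ n) (0≤+ n)) (e₁ (+ n))) (≤-by (0≤+ (suc n)) (e₂ (+ n))) (≤-by (0≤+ n) (e₃ (+ n)))
    where e₁ : ∀ n → n + n ≡ 0ℤ - - (n + n)
          e₁ = solve-∀
          e₂ : ∀ n → 1ℤ + n ≡ n + 1ℤ - 0ℤ
          e₂ = solve-∀
          e₃ : ∀ n → n ≡ n + n - n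
          e₃ = solve-∀

  lhs-inside : Inside hull-lo hull-hi (+ 0 + w) (+ n - 1ℤ + w)
  lhs-inside = inside (≤-by (+-mono-≤ gap-w (0≤+ n)) (e₁ (+ n) w)) (≤-by (0≤+ n) (e₂ (+ n) w)) (≤-by (+-mono-≤ gap-n-w (0≤+ 1)) (e₃ (+ n) w))
    where e₁ : ∀ n w → w - - n + n ≡ 0ℤ + w - - (n + n)
          e₁ = solve-∀
          e₂ : ∀ n w → n ≡ n - 1ℤ + w + 1ℤ - (0ℤ + w)
          e₂ = solve-∀
          e₃ : ∀ n w → n - w + 1ℤ ≡ n + n - (n - 1ℤ + w)
          e₃ = solve-∀

  rhs-lo : ℤ
  rhs-lo = - (+ 2 * w) - + n + m + 1ℤ

  rhs-inside : Inside hull-lo hull-hi (rhs-lo + w) (m - w + w)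
  rhs-inside = inside (≤-by (+-mono-≤ (+-mono-≤ gap-n-w (i≤j⇒0≤j-i 0≤m)) (0≤+ 1)) (e₁ (+ n) m w)) (≤-by gap-w (e₂ (+ n) m w))
                      (≤-by (i≤j⇒0≤j-i m≤2n) (e₃ (+ n) m w))
    where e₁ : ∀ n m w → n - w + (m - 0ℤ) + 1ℤ ≡ - (+ 2 * w) - n + m + 1ℤ + w - - (n + n)
          e₁ = solve-∀
          e₂ : ∀ n m w → w - - n ≡ m - w + w + 1ℤ - (- (+ 2 * w) - n + m + 1ℤ + w)
          e₂ = solve-∀
          e₃ : ∀ n m w → + 2 * n - m ≡ n + n - (m - w + w)
          e₃ = solve-∀

  -- On the left the support comes from c(n, ·), translated by w.
  lhs-supported : Supported (+ 0 + w) (+ n - 1ℤ + w) (lhsTerm n m w)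
  lhs-supported = supported-*ˡ (binom (+ n)) (supported-*ˡ (λ u → binom u (m - u)) (supported-shift w (c-supported n)))

  -- Below rhs-lo + w the top entry of the binomial inside c is negative;
  -- above m - w + w the binomial C(n, n+u-m) vanishes.
  rhs-supported : Supported (rhs-lo + w) (m - w + w) (rhsTerm n m w)
  rhs-supported = supported-*ˡ (binom (+ n)) (record
    { below = λ u u<lo →
        trans (cong (λ z → binom (+ n) (+ n + u - m) * (z * negOnePow (u - w)))
                    (binom-negTop {+ n + u + u - m - 1ℤ - (u - w)} {u - w} (<-by (gap< u<lo) (e₁ (+ n) m w u))))
              (*-zeroʳ (binom (+ n) (+ n + u - m)))
    ; above = λ u m<u → cong (_* c (+ n + u + u - m) (u - w)) (binom-above {+ n} {+ n + u - m} (<-by (gap< m<u) (e₂ (+ n) m w u))) })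
    where e₁ : ∀ n m w u → - (+ 2 * w) - n + m + 1ℤ + w - u - 1ℤ ≡ 0ℤ - (n + u + u - m - 1ℤ - (u - w)) - 1ℤ
          e₁ = solve-∀
          e₂ : ∀ n m w u → u - (m - w + w) - 1ℤ ≡ (n + u - m) - n - 1ℤ
          e₂ = solve-∀

  lhs-as-transform :
    sumRange (+ 0) (+ n - 1ℤ)
      (λ k → binom (+ n - 1ℤ - k) k * binom (+ n) (w + k) * binom (k + w) (m - k - w) * negOnePow k)
    ≡ binomialSum n (r n m w)
  lhs-as-transform =
    trans (sumRange-cong (+ 0) (+ n - 1ℤ) recentre)
      (trans (sumRange-shift (+ 0) (+ n - 1ℤ) w (lhsTerm n m w))
        (trans (sumRange-resupport (lhsTerm n m w) lhs-inside row-inside lhs-supported (supported-*ʳ _ (binom-supported n)))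
               (sumRange-from-zero n (lhsTerm n m w))))
    where
      rearrange : ∀ a b x s → a * b * x * s ≡ b * (x * (a * s))
      rearrange = solve-∀
      e₁ : ∀ w k → w + k ≡ k + w
      e₁ = solve-∀
      e₂ : ∀ m k w → m - k - w ≡ m - (k + w)
      e₂ = solve-∀
      e₃ : ∀ k w → k ≡ k + w - w
      e₃ = solve-∀
      recentre : ∀ k → binom (+ n - 1ℤ - k) k * binom (+ n) (w + k) * binom (k + w) (m - k - w) * negOnePow k
                       ≡ lhsTerm n m w (k + w)
      recentre k = trans (rearrange (binom (+ n - 1ℤ - k) k) (binom (+ n) (w + k)) (binom (k + w) (m - k - w)) (negOnePow k))
        (cong₃ (λ x y z → binom (+ n) x * (binom (k + w) y * c (+ n) z)) (e₁ w k) (e₂ m k w) (e₃ k w))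

  rhs-as-transform :
    sumRange rhs-lo (m - w)
      (λ k → binom (+ n) (k + w) * binom (+ n) (+ n + k + w - m) * binom (k + + n + + 2 * w - m - 1ℤ) k * negOnePow k)
    ≡ binomialSum n (q n n m w)
  rhs-as-transform =
    trans (sumRange-cong rhs-lo (m - w) recentre)
      (trans (sumRange-shift rhs-lo (m - w) w (rhsTerm n m w))
        (trans (sumRange-resupport (rhsTerm n m w) rhs-inside row-inside rhs-supported (supported-*ʳ _ (binom-supported n)))
               (sumRange-from-zero n (rhsTerm n m w))))
    where
      rearrange : ∀ a b x s → a * b * x * s ≡ a * (b * (x * s))
      rearrange = solve-∀
      e₁ : ∀ n k w m → n + k + w - m ≡ n + (k + w) - m
      e₁ = solve-∀
      e₂ : ∀ n k w m → k + n + + 2 * w - m - 1ℤ ≡ n + (k + w) + (k + w) - m - 1ℤ - (k + w - w)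
      e₂ = solve-∀
      e₃ : ∀ k w → k ≡ k + w - w
      e₃ = solve-∀
      recentre : ∀ k → binom (+ n) (k + w) * binom (+ n) (+ n + k + w - m) * binom (k + + n + + 2 * w - m - 1ℤ) k * negOnePow k
                       ≡ rhsTerm n m w (k + w)
      recentre k = trans (rearrange (binom (+ n) (k + w)) (binom (+ n) (+ n + k + w - m)) (binom (k + + n + + 2 * w - m - 1ℤ) k) (negOnePow k))
        (cong₃ (λ x y z → binom (+ n) (k + w) * (binom (+ n) x * (binom y z * negOnePow z))) (e₁ (+ n) k w m) (e₂ (+ n) k w m) (e₃ k w))

corollary3 : (n : ℕ) → (m w : ℤ) →
    + 1 ≤ + n → + 0 ≤ m → m ≤ + 2 * + n → - (+ n) ≤ w → w ≤ + n →
    sumRange (+ 0) (+ n - 1ℤ)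
      (λ k → binom (+ n - 1ℤ - k) k * binom (+ n) (w + k)
             * binom (k + w) (m - k - w) * negOnePow k)
    ≡ sumRange (- (+ 2 * w) - + n + m + 1ℤ) (m - w)
      (λ k → binom (+ n) (k + w) * binom (+ n) (+ n + k + w - m)
             * binom (k + + n + + 2 * w - m - 1ℤ) k * negOnePow k)
corollary3 n m w _ 0≤m m≤2n -n≤w w≤n =
  trans lhs-as-transform
    (trans (sym (transform-identity n n ℕ.≤-refl m w))
           (sym rhs-as-transform))
  where open Corollary n m w 0≤m m≤2n -n≤w w≤n
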